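{- Let $S=(V,E,F,\prec)$ be a closed simplicial surface that can be folded onto a triangle, i.e. $S$ has a vertex-3-colouring $c_V$ and there exists a triangle-folding of $S$ with respect to $c_V$. Then $S$ has a simplicial orientation.
   Context: A simplicial surface is a quadruple $(V,E,F,\prec)$ where $V,E,F$ are finite sets (vertices, edges, faces) and $\prec\subset (V\times E)\uplus(V\times F)\uplus(E\times F)$ is a transitive relation (incidence) such that: every edge is incident to exactly two vertices; for every face $f$ there are three vertices $v_1,v_2,v_3$ and three edges $e_1,e_2,e_3$ incident to $f$ with $v_i,v_{i+1}$ incident to $e_i$ ($v_4:=v_1$); every edge is incident to at most two faces; for every vertex $v$ there is a finite sequence $(e_1,f_1,e_2,f_2,\dots)$ whose $e_i$ are pairwise distinct and are exactly the edges incident to $v$, whose $f_i$ are pairwise distinct and are exactly the faces incident to $v$, with $e_i,e_{i+1}$ incident to $f_i$, and such that if the sequence ends with a face then $e_1$ is incident to that face; every vertex is incident to some edge; every edge is incident to some face. It is closed if every edge is incident to exactly two faces. A vertex-3-colouring is a map $c_V:V\to\{1,2,3\}$ such that the two vertices of any edge get different colours. The induced edge-3-colouring is $c_E(e)=c_V(v_1)+c_V(v_2)-2$ where $v_1,v_2$ are the vertices of $e$. A triangle-folding is a total order $<$ on $F$ such that whenever two edges have face sets $\{f_1,f_2\}$ and $\{g_1,g_2\}$ with $f_1<g_1<f_2<g_2$, these edges have different colours under $c_E$. A simplicial orientation is a map $z:F\to\{(1,2,3),(1,3,2)\}$ (values in $\mathrm{Sym}(\{1,2,3\})$) such that for any two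 faces $f_1,f_2$ with a common edge, $z(f_1)=z(f_2)^{ -1}$. -}

module Defs where

open import Level using (0ℓ)
open import Data.Nat using (ℕ; zero; suc; _+_; _%_)
open import Data.Nat.DivMod using (m%n<n)
open import Data.Fin using (Fin; toℕ; fromℕ<)
open import Data.Product using (Σ; _×_; _,_; ∃; ∃-syntax)
open import Data.Sum using (_⊎_)
open import Relation.Nullary using (¬_)
open import Relation.Binary.PropositionalEquality using (_≡_; _≢_)
open import Relation.Binary.Structures using (IsStrictTotalOrder)
open import Function using (_⇔_)
open import Function.Definitions using (Injective)

modFin : (k' j : ℕ) → Fin (suc k')
modFin k' j = fromℕ< (m%n<n j (suc k'))

-- A simplicial surface with vertex set Fin nV, edge set Fin nE, face set Fin nF.
-- The incidence relation ≺ is split into its three parts VE, VF, EF.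
record SimplicialSurface : Set₁ where
  field
    nV nE nF : ℕ
    VE : Fin nV → Fin nE → Set
    VF : Fin nV → Fin nF → Set
    EF : Fin nE → Fin nF → Set
    trans-VEF : ∀ {v e f} → VE v e → EF e f → VF v f
    edge-two-vertices : ∀ e → Σ (Fin nV) λ v₁ → Σ (Fin nV) λ v₂ →
      v₁ ≢ v₂ × VE v₁ e × VE v₂ e × (∀ v → VE v e → v ≡ v₁ ⊎ v ≡ v₂)
    face-triangle : ∀ f →
      Σ (Fin nV) λ v₁ → Σ (Fin nV) λ v₂ → Σ (Fin nV) λ v₃ →
      Σ (Fin nE) λ e₁ → Σ (Fin nE) λ e₂ → Σ (Fin nE) λ e₃ →
        (v₁ ≢ v₂ × v₂ ≢ v₃ × v₁ ≢ v₃) ×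
        (e₁ ≢ e₂ × e₂ ≢ e₃ × e₁ ≢ e₃) ×
        (VF v₁ f × VF v₂ f × VF v₃ f) ×
        (EF e₁ f × EF e₂ f × EF e₃ f) ×
        (VE v₁ e₁ × VE v₂ e₁) × (VE v₂ e₂ × VE v₃ e₂) × (VE v₃ e₃ × VE v₁ e₃) ×
        (∀ v → VF v f → v ≡ v₁ ⊎ v ≡ v₂ ⊎ v ≡ v₃) ×
        (∀ e → EF e f → e ≡ e₁ ⊎ e ≡ e₂ ⊎ e ≡ e₃)
    edge-at-most-two-faces : ∀ e f₁ f₂ f₃ → EF e f₁ → EF e f₂ → EF e f₃ →
      f₁ ≡ f₂ ⊎ f₂ ≡ f₃ ⊎ f₁ ≡ f₃
    -- umbrella condition: sequence (e₁, f₁, e₂, f₂, …) with suc k' edges and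
    -- m faces; m ≡ suc k' means the sequence ends with a face (then the last
    -- face is incident to e₁, via the index reduction modulo suc k').
    umbrella : ∀ v → Σ ℕ λ k' → Σ ℕ λ m →
      Σ (Fin (suc k') → Fin nE) λ es → Σ (Fin m → Fin nF) λ fs →
        (m ≡ suc k' ⊎ suc m ≡ suc k') ×
        Injective _≡_ _≡_ es × Injective _≡_ _≡_ fs ×
        (∀ e → VE v e ⇔ (∃[ i ] es i ≡ e)) ×
        (∀ f → VF v f ⇔ (∃[ i ] fs i ≡ f)) ×
        (∀ i → EF (es (modFin k' (toℕ i))) (fs i) ×
               EF (es (modFin k' (suc (toℕ i)))) (fs i))
    vertex-has-edge : ∀ v → ∃[ e ] VE v e
    edge-has-face : ∀ e → ∃[ f ] EF e f

module _ (S : SimplicialSurface) where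
  open SimplicialSurface S

  Closed : Set
  Closed = ∀ e → Σ (Fin nF) λ f₁ → Σ (Fin nF) λ f₂ →
    f₁ ≢ f₂ × EF e f₁ × EF e f₂ × (∀ f → EF e f → f ≡ f₁ ⊎ f ≡ f₂)

  -- colours {1,2,3} are represented by Fin 3 = {0,1,2} (colour c ↦ toℕ c + 1)
  IsVertex3Colouring : (Fin nV → Fin 3) → Set
  IsVertex3Colouring c = ∀ v₁ v₂ e → v₁ ≢ v₂ → VE v₁ e → VE v₂ e → c v₁ ≢ c v₂

  -- induced edge colour: c_E(e) = c_V(v₁) + c_V(v₂) - 2 with colours in {1,2,3};
  -- with colours shifted to {0,1,2} this is toℕ (c v₁) + toℕ (c v₂).
  EdgeColour : (Fin nV → Fin 3) → Fin nE → ℕ → Set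
  EdgeColour c e n = Σ (Fin nV) λ v₁ → Σ (Fin nV) λ v₂ →
    v₁ ≢ v₂ × VE v₁ e × VE v₂ e × n ≡ toℕ (c v₁) + toℕ (c v₂)

  IsTriangleFolding : (Fin nV → Fin 3) → (Fin nF → Fin nF → Set) → Set
  IsTriangleFolding c _<_ =
    IsStrictTotalOrder _≡_ _<_ ×
    (∀ e e' f₁ f₂ g₁ g₂ →
      EF e f₁ → EF e f₂ → f₁ ≢ f₂ →
      EF e' g₁ → EF e' g₂ → g₁ ≢ g₂ →
      f₁ < g₁ → g₁ < f₂ → f₂ < g₂ →
      ∀ n n' → EdgeColour c e n → EdgeColour c e' n' → n ≢ n')

-- the two 3-cycles (1,2,3) and (1,3,2) of Sym({1,2,3})
data Cycle3 : Set where
  c123 c132 : Cycle3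

_⁻¹ : Cycle3 → Cycle3
c123 ⁻¹ = c132
c132 ⁻¹ = c123

module _ (S : SimplicialSurface) where
  open SimplicialSurface S

  IsSimplicialOrientation : (Fin nF → Cycle3) → Set
  IsSimplicialOrientation z = ∀ f₁ f₂ e → f₁ ≢ f₂ → EF e f₁ → EF e f₂ →
    z f₁ ≡ (z f₂) ⁻¹

-- Orient each face by the parity of the number of faces below it in the folding order.
-- Every face has exactly one side of each edge colour, so for a colour k the map σ sending
-- a face to its neighbour across its side of colour k is a fixed-point-free involution. If
-- f₁ < f₂ share an edge of colour k, σ maps the faces strictly between f₁ and f₂ to each
-- other: otherwise two edges of colour k would interleave, which the folding forbids.
-- So f₁ and f₂ differ in rank by an odd number and receive opposite orientations.
module Submission where

open import Data.Empty using (⊥-elim)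
open import Data.Fin using (Fin; zero; suc; toℕ; _≟_)
open import Data.Fin.Properties using (suc-injective; toℕ-injective; all?)
open import Data.Nat using (ℕ; zero; suc; _+_; parity)
import Data.Nat.Properties as ℕ
open import Data.Parity.Base as ℙ using (Parity; 0ℙ; 1ℙ)
open import Data.Parity.Properties using (+-homo-+; suc-homo-⁻¹; ⁻¹-selfInverse)
import Data.Product as Product
open import Data.Product using (Σ; ∃-syntax; _×_; _,_; proj₁; proj₂)
open import Data.Sum using (_⊎_; inj₁; inj₂)
open import Function using (_∘_; id)
open import Level using (Level; 0ℓ)
open import Relation.Binary.Core using (Rel)
open import Relation.Binary.Definitions using (tri<; tri≈; tri>)
open import Relation.Binary.PropositionalEquality
open import Relation.Binary.Structures using (IsStrictTotalOrder)
open import Relation.Nullary using (yes; no; ¬?; _→-dec_; _⊎-dec_)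
open import Relation.Nullary.Decidable using (toWitness)
open import Relation.Unary using (Pred; Decidable; Satisfiable; _∩_; ∁; _⊆_; _≐_; _∈_)
open import Relation.Unary.Properties using (_∩?_; ∁?)

open import Defs

private variable
  ℓ ℓ′ : Level
  n : ℕ

count : {P : Pred (Fin n) ℓ} → Decidable P → ℕ
count {n = zero}  P? = 0
count {n = suc n} P? with P? zero
... | yes _ = suc (count (P? ∘ suc))
... | no  _ = count (P? ∘ suc)

count-cong : {P : Pred (Fin n) ℓ} {Q : Pred (Fin n) ℓ′} (P? : Decidable P) (Q? : Decidable Q) →
             P ≐ Q → count P? ≡ count Q?
count-cong {n = zero}  P? Q? _ = refl
count-cong {n = suc n} P? Q? (P⊆Q , Q⊆P) with P? zero | Q? zero
... | yes _ | yes _  = cong suc (count-cong (P? ∘ suc) (Q? ∘ suc) (P⊆Q , Q⊆P))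
... | yes p | no ¬q  = ⊥-elim (¬q (P⊆Q p))
... | no ¬p | yes q  = ⊥-elim (¬p (Q⊆P q))
... | no _  | no _   = count-cong (P? ∘ suc) (Q? ∘ suc) (P⊆Q , Q⊆P)

count-split : {P : Pred (Fin n) ℓ} {Q : Pred (Fin n) ℓ′} (P? : Decidable P) (Q? : Decidable Q) →
              count P? ≡ count (P? ∩? Q?) + count (P? ∩? ∁? Q?)
count-split {n = zero}  P? Q? = refl
count-split {n = suc n} P? Q? with P? zero | Q? zero
... | yes _ | yes _ = cong suc (count-split (P? ∘ suc) (Q? ∘ suc))
... | yes _ | no _  = trans (cong suc (count-split (P? ∘ suc) (Q? ∘ suc))) (sym (ℕ.+-suc _ _))
... | no _  | yes _ = count-split (P? ∘ suc) (Q? ∘ suc)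
... | no _  | no _  = count-split (P? ∘ suc) (Q? ∘ suc)

remove-suc : {P : Pred (Fin (suc n)) ℓ} {a : Fin n} →
             (P ∘ suc) ∩ ∁ (_≡ a) ≐ (P ∩ ∁ (_≡ suc a)) ∘ suc
remove-suc = (λ (p , i≢a) → p , i≢a ∘ suc-injective) , (λ (p , si≢sa) → p , si≢sa ∘ cong suc)

count-remove : {P : Pred (Fin n) ℓ} (P? : Decidable P) {a : Fin n} → a ∈ P →
               count P? ≡ suc (count (P? ∩? ∁? (_≟ a)))
count-remove {n = suc n} P? {zero} Pa with P? zero
... | no ¬Pa = ⊥-elim (¬Pa Pa)
... | yes _  = cong suc (count-cong (P? ∘ suc) _ ((_, λ ()) , proj₁))
count-remove {n = suc n} {P = P} P? {suc a} Pa with P? zero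
... | yes _ = cong suc (trans (count-remove (P? ∘ suc) Pa)
                             (cong suc (count-cong ((P? ∘ suc) ∩? ∁? (_≟ a)) _ (remove-suc {P = P}))))
... | no _  = trans (count-remove (P? ∘ suc) Pa)
                    (cong suc (count-cong ((P? ∘ suc) ∩? ∁? (_≟ a)) _ (remove-suc {P = P})))

count≡suc⇒Satisfiable : {P : Pred (Fin n) ℓ} (P? : Decidable P) {m : ℕ} →
                        count P? ≡ suc m → Satisfiable P
count≡suc⇒Satisfiable {n = suc n} P? eq with P? zero
... | yes p = zero , p
... | no _  = Product.map suc id (count≡suc⇒Satisfiable (P? ∘ suc) eq)

record IsFixedPointFreeInvolutionOn (P : Pred (Fin n) ℓ) (σ : Fin n → Fin n) : Set ℓ where
  field
    closed         : ∀ {i} → i ∈ P → σ i ∈ P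
    fixedPointFree : ∀ {i} → i ∈ P → σ i ≢ i
    involutive     : ∀ {i} → i ∈ P → σ (σ i) ≡ i

  injective : ∀ {i j} → i ∈ P → j ∈ P → σ i ≡ σ j → i ≡ j
  injective Pi Pj σi≡σj = trans (sym (involutive Pi)) (trans (cong σ σi≡σj) (involutive Pj))

module _ {σ : Fin n → Fin n} where

  orbit-removed : {P : Pred (Fin n) ℓ} → IsFixedPointFreeInvolutionOn P σ → ∀ {i} → i ∈ P →
                  IsFixedPointFreeInvolutionOn ((P ∩ ∁ (_≡ i)) ∩ ∁ (_≡ σ i)) σ
  orbit-removed inv {i} Pi = record
    { closed         = λ ((Pj , j≢i) , j≢σi) →
                         ( closed Pj
                         , λ σj≡i → j≢σi (injective Pj (closed Pi) (trans σj≡i (sym (involutive Pi)))))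
                         , j≢i ∘ injective Pj Pi
    ; fixedPointFree = fixedPointFree ∘ proj₁ ∘ proj₁
    ; involutive     = involutive ∘ proj₁ ∘ proj₁
    }
    where open IsFixedPointFreeInvolutionOn inv

  count-remove-orbit : {P : Pred (Fin n) ℓ} (P? : Decidable P) → IsFixedPointFreeInvolutionOn P σ →
                       ∀ {i} → i ∈ P → count P? ≡ 2 + count ((P? ∩? ∁? (_≟ i)) ∩? ∁? (_≟ σ i))
  count-remove-orbit P? inv {i} Pi =
    trans (count-remove P? Pi) (cong suc (count-remove (P? ∩? ∁? (_≟ i)) (closed Pi , fixedPointFree Pi)))
    where open IsFixedPointFreeInvolutionOn inv

  fixedPointFreeInvolution⇒count-even : {P : Pred (Fin n) ℓ} (P? : Decidable P) →
                                        IsFixedPointFreeInvolutionOn P σ → parity (count P?) ≡ 0ℙ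
  fixedPointFreeInvolution⇒count-even P? inv = even _ P? inv refl
    where
    even : ∀ m {P : Pred (Fin n) ℓ} (P? : Decidable P) → IsFixedPointFreeInvolutionOn P σ →
           count P? ≡ m → parity m ≡ 0ℙ
    even zero          _  _   _  = refl
    even (suc zero)    P? inv eq with i , Pi ← count≡suc⇒Satisfiable P? eq
      with () ← trans (sym eq) (count-remove-orbit P? inv Pi)
    even (suc (suc m)) P? inv eq with i , Pi ← count≡suc⇒Satisfiable P? eq =
      even m _ (orbit-removed inv Pi)
        (ℕ.suc-injective (ℕ.suc-injective (trans (sym (count-remove-orbit P? inv Pi)) eq)))

module Rank {_<_ : Rel (Fin n) ℓ} (sto : IsStrictTotalOrder _≡_ _<_) where
  open IsStrictTotalOrder sto using (_<?_; compare; irrefl) renaming (trans to <-trans)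

  rank : Fin n → ℕ
  rank b = count (_<? b)

  rank-split : ∀ {a b} → a < b → rank b ≡ count ((a <?_) ∩? (_<? b)) + suc (rank a)
  rank-split {a} {b} a<b = begin
    rank b
      ≡⟨ count-split (_<? b) (a <?_) ⟩
    count ((_<? b) ∩? (a <?_)) + count ((_<? b) ∩? ∁? (a <?_))
      ≡⟨ cong₂ _+_ (count-cong ((_<? b) ∩? (a <?_)) ((a <?_) ∩? (_<? b)) (Product.swap , Product.swap))
                   (count-remove ((_<? b) ∩? ∁? (a <?_)) (a<b , irrefl refl)) ⟩
    count ((a <?_) ∩? (_<? b)) + suc (count (((_<? b) ∩? ∁? (a <?_)) ∩? ∁? (_≟ a)))
      ≡⟨ cong (λ k → count ((a <?_) ∩? (_<? b)) + suc k)
           (count-cong (((_<? b) ∩? ∁? (a <?_)) ∩? ∁? (_≟ a)) (_<? a) (below-a , above-a)) ⟩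
    count ((a <?_) ∩? (_<? b)) + suc (rank a) ∎
    where
    open ≡-Reasoning
    below-a : ((_< b) ∩ ∁ (a <_)) ∩ ∁ (_≡ a) ⊆ (_< a)
    below-a {g} ((_ , a≮g) , g≢a) with compare g a
    ... | tri< g<a _ _ = g<a
    ... | tri≈ _ g≡a _ = ⊥-elim (g≢a g≡a)
    ... | tri> _ _ a<g = ⊥-elim (a≮g a<g)
    above-a : (_< a) ⊆ ((_< b) ∩ ∁ (a <_)) ∩ ∁ (_≡ a)
    above-a g<a = (<-trans g<a a<b , λ a<g → irrefl refl (<-trans a<g g<a)) , λ g≡a → irrefl g≡a g<a

-- x + y (for x ≢ y) determines the colour missing from {x, y}, and the three sides of a
-- properly coloured triangle miss the three colours in turn. The proof is by evaluation; it is
-- opaque so that with-abstractions over its uses never unfold it.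
opaque
  pair-sum-is-side-sum : (a b d x y : Fin 3) → a ≢ b → b ≢ d → d ≢ a → x ≢ y →
    toℕ x + toℕ y ≡ toℕ a + toℕ b ⊎ toℕ x + toℕ y ≡ toℕ b + toℕ d ⊎ toℕ x + toℕ y ≡ toℕ d + toℕ a
  pair-sum-is-side-sum = toWitness {a? = all? λ a → all? λ b → all? λ d → all? λ x → all? λ y →
    ¬? (a ≟ b) →-dec ¬? (b ≟ d) →-dec ¬? (d ≟ a) →-dec ¬? (x ≟ y) →-dec
    ((toℕ x + toℕ y ℕ.≟ toℕ a + toℕ b) ⊎-dec (toℕ x + toℕ y ℕ.≟ toℕ b + toℕ d) ⊎-dec
     (toℕ x + toℕ y ℕ.≟ toℕ d + toℕ a))} _

injective-on-distinct-triple : {A B : Set} (f : A → B) {x₁ x₂ x₃ y y′ : A} →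
  f x₁ ≢ f x₂ → f x₂ ≢ f x₃ → f x₃ ≢ f x₁ →
  y ≡ x₁ ⊎ y ≡ x₂ ⊎ y ≡ x₃ → y′ ≡ x₁ ⊎ y′ ≡ x₂ ⊎ y′ ≡ x₃ → f y ≡ f y′ → y ≡ y′
injective-on-distinct-triple f d₁₂ d₂₃ d₃₁ (inj₁ refl)        (inj₁ refl)        eq = refl
injective-on-distinct-triple f d₁₂ d₂₃ d₃₁ (inj₁ refl)        (inj₂ (inj₁ refl)) eq = ⊥-elim (d₁₂ eq)
injective-on-distinct-triple f d₁₂ d₂₃ d₃₁ (inj₁ refl)        (inj₂ (inj₂ refl)) eq = ⊥-elim (d₃₁ (sym eq))
injective-on-distinct-triple f d₁₂ d₂₃ d₃₁ (inj₂ (inj₁ refl)) (inj₁ refl)        eq = ⊥-elim (d₁₂ (sym eq))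
injective-on-distinct-triple f d₁₂ d₂₃ d₃₁ (inj₂ (inj₁ refl)) (inj₂ (inj₁ refl)) eq = refl
injective-on-distinct-triple f d₁₂ d₂₃ d₃₁ (inj₂ (inj₁ refl)) (inj₂ (inj₂ refl)) eq = ⊥-elim (d₂₃ eq)
injective-on-distinct-triple f d₁₂ d₂₃ d₃₁ (inj₂ (inj₂ refl)) (inj₁ refl)        eq = ⊥-elim (d₃₁ eq)
injective-on-distinct-triple f d₁₂ d₂₃ d₃₁ (inj₂ (inj₂ refl)) (inj₂ (inj₁ refl)) eq = ⊥-elim (d₂₃ (sym eq))
injective-on-distinct-triple f d₁₂ d₂₃ d₃₁ (inj₂ (inj₂ refl)) (inj₂ (inj₂ refl)) eq = refl

module EdgeColouring (S : SimplicialSurface) {c : Fin (SimplicialSurface.nV S) → Fin 3}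
                     (proper : IsVertex3Colouring S c) where
  open SimplicialSurface S

  edgeColour : Fin nE → ℕ
  edgeColour e with v₁ , v₂ , _ ← edge-two-vertices e = toℕ (c v₁) + toℕ (c v₂)

  edgeColour-isEdgeColour : ∀ e → EdgeColour S c e (edgeColour e)
  edgeColour-isEdgeColour e with v₁ , v₂ , v₁≢v₂ , v₁e , v₂e , _ ← edge-two-vertices e =
    v₁ , v₂ , v₁≢v₂ , v₁e , v₂e , refl

  edgeColour-ends : ∀ {v w e} → v ≢ w → VE v e → VE w e → edgeColour e ≡ toℕ (c v) + toℕ (c w)
  edgeColour-ends {v} {w} {e} v≢w ve we with v₁ , v₂ , _ , _ , _ , ends ← edge-two-vertices e
    with ends v ve | ends w we
  ... | inj₁ refl | inj₁ refl = ⊥-elim (v≢w refl)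
  ... | inj₁ refl | inj₂ refl = refl
  ... | inj₂ refl | inj₁ refl = ℕ.+-comm (toℕ (c v₁)) (toℕ (c v₂))
  ... | inj₂ refl | inj₂ refl = ⊥-elim (v≢w refl)

  triangle-sides-edgeColour-≢ : ∀ {w u u′ e e′ e″} → w ≢ u → w ≢ u′ → u′ ≢ u →
    VE w e → VE u e → VE w e′ → VE u′ e′ → VE u′ e″ → VE u e″ → edgeColour e ≢ edgeColour e′
  triangle-sides-edgeColour-≢ {w} w≢u w≢u′ u′≢u we ue we′ u′e′ u′e″ ue″ eq =
    proper _ _ _ u′≢u u′e″ ue″ (toℕ-injective (ℕ.+-cancelˡ-≡ (toℕ (c w)) _ _
      (trans (sym (edgeColour-ends w≢u′ we′ u′e′)) (trans (sym eq) (edgeColour-ends w≢u we ue)))))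

  edge-of-colour : ∀ f e → ∃[ e′ ] EF e′ f × edgeColour e′ ≡ edgeColour e
  edge-of-colour f e
    with x , y , x≢y , xe , ye , xy ← edgeColour-isEdgeColour e
       | v₁ , v₂ , v₃ , e₁ , e₂ , e₃ , (v₁≢v₂ , v₂≢v₃ , v₁≢v₃) , _ , _ , (e₁f , e₂f , e₃f)
         , (v₁e₁ , v₂e₁) , (v₂e₂ , v₃e₂) , (v₃e₃ , v₁e₃) , _ ← face-triangle f
    with pair-sum-is-side-sum (c v₁) (c v₂) (c v₃) (c x) (c y)
           (proper _ _ _ v₁≢v₂ v₁e₁ v₂e₁) (proper _ _ _ v₂≢v₃ v₂e₂ v₃e₂)
           (proper _ _ _ (v₁≢v₃ ∘ sym) v₃e₃ v₁e₃) (proper _ _ _ x≢y xe ye)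
  ... | inj₁ s        = e₁ , e₁f , trans (edgeColour-ends v₁≢v₂ v₁e₁ v₂e₁) (sym (trans xy s))
  ... | inj₂ (inj₁ s) = e₂ , e₂f , trans (edgeColour-ends v₂≢v₃ v₂e₂ v₃e₂) (sym (trans xy s))
  ... | inj₂ (inj₂ s) = e₃ , e₃f , trans (edgeColour-ends (v₁≢v₃ ∘ sym) v₃e₃ v₁e₃) (sym (trans xy s))

  edgeColour-injective-on-face : ∀ {f e e′} → EF e f → EF e′ f → edgeColour e ≡ edgeColour e′ → e ≡ e′
  edgeColour-injective-on-face {f} ef e′f
    with v₁ , v₂ , v₃ , e₁ , e₂ , e₃ , (v₁≢v₂ , v₂≢v₃ , v₁≢v₃) , _ , _ , _
         , (v₁e₁ , v₂e₁) , (v₂e₂ , v₃e₂) , (v₃e₃ , v₁e₃) , _ , sides ← face-triangle f =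
    injective-on-distinct-triple edgeColour
      (triangle-sides-edgeColour-≢ (v₁≢v₂ ∘ sym) v₂≢v₃ (v₁≢v₃ ∘ sym) v₂e₁ v₁e₁ v₂e₂ v₃e₂ v₃e₃ v₁e₃)
      (triangle-sides-edgeColour-≢ (v₂≢v₃ ∘ sym) (v₁≢v₃ ∘ sym) v₁≢v₂ v₃e₂ v₂e₂ v₃e₃ v₁e₃ v₁e₁ v₂e₁)
      (triangle-sides-edgeColour-≢ v₁≢v₃ v₁≢v₂ v₂≢v₃ v₁e₃ v₃e₃ v₁e₁ v₂e₁ v₂e₂ v₃e₂)
      (sides _ ef) (sides _ e′f)

toCycle3 : Parity → Cycle3
toCycle3 0ℙ = c123
toCycle3 1ℙ = c132

toCycle3-⁻¹ : ∀ p → toCycle3 (p ℙ.⁻¹) ≡ toCycle3 p ⁻¹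
toCycle3-⁻¹ 0ℙ = refl
toCycle3-⁻¹ 1ℙ = refl

⁻¹-involutive : ∀ z → z ⁻¹ ⁻¹ ≡ z
⁻¹-involutive c123 = refl
⁻¹-involutive c132 = refl

module TriangleFolding (S : SimplicialSurface) (closed : Closed S)
                       {c : Fin (SimplicialSurface.nV S) → Fin 3} (proper : IsVertex3Colouring S c)
                       {_<_ : Fin (SimplicialSurface.nF S) → Fin (SimplicialSurface.nF S) → Set}
                       (folding : IsTriangleFolding S c _<_) where
  open SimplicialSurface S
  open EdgeColouring S proper
  open IsStrictTotalOrder (proj₁ folding) using (compare; irrefl; _<?_) renaming (trans to <-trans)
  open Rank (proj₁ folding)

  <⇒≢ : ∀ {f g} → f < g → f ≢ g
  <⇒≢ f<g f≡g = irrefl f≡g f<g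

  interleaved⇒edgeColour-≢ : ∀ {e e′ f₁ f₂ g₁ g₂} → EF e f₁ → EF e f₂ → EF e′ g₁ → EF e′ g₂ →
                             f₁ < g₁ → g₁ < f₂ → f₂ < g₂ → edgeColour e ≢ edgeColour e′
  interleaved⇒edgeColour-≢ {e} {e′} ef₁ ef₂ e′g₁ e′g₂ f₁<g₁ g₁<f₂ f₂<g₂ =
    proj₂ folding e e′ _ _ _ _ ef₁ ef₂ (<⇒≢ (<-trans f₁<g₁ g₁<f₂)) e′g₁ e′g₂ (<⇒≢ (<-trans g₁<f₂ f₂<g₂))
      f₁<g₁ g₁<f₂ f₂<g₂ _ _ (edgeColour-isEdgeColour e) (edgeColour-isEdgeColour e′)

  across : ∀ e g → ∃[ h ] EF e h × h ≢ g
  across e g with f₁ , f₂ , f₁≢f₂ , ef₁ , ef₂ , _ ← closed e with g ≟ f₁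
  ... | yes refl = f₂ , ef₂ , f₁≢f₂ ∘ sym
  ... | no g≢f₁  = f₁ , ef₁ , g≢f₁ ∘ sym

  other-face-unique : ∀ {e g h h′} → EF e g → EF e h → EF e h′ → h ≢ g → h′ ≢ g → h ≡ h′
  other-face-unique {e} eg eh eh′ h≢g h′≢g with edge-at-most-two-faces e _ _ _ eg eh eh′
  ... | inj₁ g≡h        = ⊥-elim (h≢g (sym g≡h))
  ... | inj₂ (inj₁ h≡h′) = h≡h′
  ... | inj₂ (inj₂ g≡h′) = ⊥-elim (h′≢g (sym g≡h′))

  module Reflection (e₀ : Fin nE) where
    side : Fin nF → Fin nE
    side g = proj₁ (edge-of-colour g e₀)

    side-EF : ∀ g → EF (side g) g
    side-EF g = proj₁ (proj₂ (edge-of-colour g e₀))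

    side-edgeColour : ∀ g → edgeColour (side g) ≡ edgeColour e₀
    side-edgeColour g = proj₂ (proj₂ (edge-of-colour g e₀))

    σ : Fin nF → Fin nF
    σ g = proj₁ (across (side g) g)

    σ-EF : ∀ g → EF (side g) (σ g)
    σ-EF g = proj₁ (proj₂ (across (side g) g))

    σ-≢ : ∀ g → σ g ≢ g
    σ-≢ g = proj₂ (proj₂ (across (side g) g))

    σ-unique : ∀ {e g h} → EF e g → EF e h → h ≢ g → edgeColour e ≡ edgeColour e₀ → σ g ≡ h
    σ-unique {g = g} eg eh h≢g e∼e₀ with refl ← edgeColour-injective-on-face eg (side-EF g)
                                                   (trans e∼e₀ (sym (side-edgeColour g)))
      = other-face-unique (side-EF g) (σ-EF g) eh (σ-≢ g) h≢g

    σ-involutive : ∀ g → σ (σ g) ≡ g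
    σ-involutive g = σ-unique (σ-EF g) (side-EF g) (σ-≢ g ∘ sym) (side-edgeColour g)

    σ≡⇒≡σ : ∀ {g h} → σ g ≡ h → g ≡ σ h
    σ≡⇒≡σ {g} σg≡h = trans (sym (σ-involutive g)) (cong σ σg≡h)

    module _ {f₁ f₂} (f₁<f₂ : f₁ < f₂) (e₀f₁ : EF e₀ f₁) (e₀f₂ : EF e₀ f₂) where
      Between : Pred (Fin nF) 0ℓ
      Between g = f₁ < g × g < f₂

      σf₁≡f₂ : σ f₁ ≡ f₂
      σf₁≡f₂ = σ-unique e₀f₁ e₀f₂ (<⇒≢ f₁<f₂ ∘ sym) refl

      σf₂≡f₁ : σ f₂ ≡ f₁
      σf₂≡f₁ = σ-unique e₀f₂ e₀f₁ (<⇒≢ f₁<f₂) refl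

      σ-preserves-Between : ∀ {g} → Between g → Between (σ g)
      σ-preserves-Between {g} (f₁<g , g<f₂) with compare (σ g) f₁
      ... | tri< σg<f₁ _ _ = ⊥-elim (interleaved⇒edgeColour-≢ (σ-EF g) (side-EF g) e₀f₁ e₀f₂
                                        σg<f₁ f₁<g g<f₂ (side-edgeColour g))
      ... | tri≈ _ σg≡f₁ _ = ⊥-elim (<⇒≢ g<f₂ (trans (σ≡⇒≡σ σg≡f₁) σf₁≡f₂))
      ... | tri> _ _ f₁<σg with compare (σ g) f₂
      ...   | tri< σg<f₂ _ _ = f₁<σg , σg<f₂
      ...   | tri≈ _ σg≡f₂ _ = ⊥-elim (<⇒≢ f₁<g (sym (trans (σ≡⇒≡σ σg≡f₂) σf₂≡f₁)))
      ...   | tri> _ _ f₂<σg = ⊥-elim (interleaved⇒edgeColour-≢ e₀f₁ e₀f₂ (side-EF g) (σ-EF g)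
                                        f₁<g g<f₂ f₂<σg (sym (side-edgeColour g)))

      σ-fixedPointFreeInvolution : IsFixedPointFreeInvolutionOn Between σ
      σ-fixedPointFreeInvolution = record
        { closed         = σ-preserves-Between
        ; fixedPointFree = λ {g} _ → σ-≢ g
        ; involutive     = λ {g} _ → σ-involutive g
        }

  open Reflection using (σ-fixedPointFreeInvolution)

  rank-parity-flips : ∀ {e f₁ f₂} → f₁ < f₂ → EF e f₁ → EF e f₂ → parity (rank f₂) ≡ parity (rank f₁) ℙ.⁻¹
  rank-parity-flips {e} {f₁} {f₂} f₁<f₂ ef₁ ef₂ = begin
    parity (rank f₂)
      ≡⟨ cong parity (rank-split f₁<f₂) ⟩
    parity (count between? + suc (rank f₁))
      ≡⟨ +-homo-+ (count between?) (suc (rank f₁)) ⟩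
    parity (count between?) ℙ.+ parity (suc (rank f₁))
      ≡⟨ cong (ℙ._+ parity (suc (rank f₁)))
              (fixedPointFreeInvolution⇒count-even between? (σ-fixedPointFreeInvolution e f₁<f₂ ef₁ ef₂)) ⟩
    parity (suc (rank f₁))
      ≡⟨ sym (⁻¹-selfInverse (suc-homo-⁻¹ (rank f₁))) ⟩
    parity (rank f₁) ℙ.⁻¹ ∎
    where
    open ≡-Reasoning
    between? : Decidable ((f₁ <_) ∩ (_< f₂))
    between? = (f₁ <?_) ∩? (_<? f₂)

  orientation : Fin nF → Cycle3
  orientation f = toCycle3 (parity (rank f))

  orientation-flips : ∀ {e f₁ f₂} → f₁ < f₂ → EF e f₁ → EF e f₂ → orientation f₂ ≡ orientation f₁ ⁻¹
  orientation-flips f₁<f₂ ef₁ ef₂ = trans (cong toCycle3 (rank-parity-flips f₁<f₂ ef₁ ef₂)) (toCycle3-⁻¹ _)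

  orientation-isSimplicialOrientation : IsSimplicialOrientation S orientation
  orientation-isSimplicialOrientation f₁ f₂ e f₁≢f₂ ef₁ ef₂ with compare f₁ f₂
  ... | tri< f₁<f₂ _ _ = begin
    orientation f₁         ≡⟨ sym (⁻¹-involutive _) ⟩
    orientation f₁ ⁻¹ ⁻¹   ≡⟨ cong _⁻¹ (sym (orientation-flips f₁<f₂ ef₁ ef₂)) ⟩
    orientation f₂ ⁻¹      ∎
    where open ≡-Reasoning
  ... | tri≈ _ f₁≡f₂ _ = ⊥-elim (f₁≢f₂ f₁≡f₂)
  ... | tri> _ _ f₂<f₁ = orientation-flips f₂<f₁ ef₂ ef₁

open SimplicialSurface

theorem5p6 : (S : SimplicialSurface) → Closed S →
    (Σ (Fin (nV S) → Fin 3) λ c → IsVertex3Colouring S c ×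
      Σ (Fin (nF S) → Fin (nF S) → Set) λ _<_ → IsTriangleFolding S c _<_) →
    Σ (Fin (nF S) → Cycle3) λ z → IsSimplicialOrientation S z
theorem5p6 S closed (c , proper , _<_ , folding) = orientation , orientation-isSimplicialOrientation
  where open TriangleFolding S closed proper folding
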